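{- Let $\mathbb{K}=(G,M,I)$ be a finite formal context with $g\in G$ and $m\in M$. Then: (1) $\gamma g$ is supremum-irreducible in $(\mu m]$ if and only if there exists $n\in M$ with $g\swarrow n$ and $g\nearrow n$ in the (clarified) subcontext $\mathbb{K}|_{m',M}$; (2) $\mu m$ is infimum-irreducible in $[\gamma g)$ if and only if there exists $h\in G$ with $h\swarrow m$ and $h\nearrow m$ in the (clarified) subcontext $\mathbb{K}|_{G,g'}$.
   Context: For a formal context $(G,M,I)$, derivations are $A'=\{m\mid (g,m)\in I\ \forall g\in A\}$, $B'=\{g\mid (g,m)\in I\ \forall m\in B\}$, with $g'=\{g\}'$, $m'=\{m\}'$; formal concepts are pairs $(A,B)$ with $A'=B$, $B'=A$, ordered by extent inclusion. The object concept of $g$ is $\gamma g=(g'',g')$ and the attribute concept of $m$ is $\mu m=(m',m'')$. $(c]=\{x\mid x\le c\}$, $[c)=\{x\mid c\le x\}$. An element $c$ of a finite lattice is supremum-irreducible if it has exactly one lower neighbour and infimum-irreducible if it has exactly one upper neighbour. For $H\subseteq G$, $N\subseteq M$, $\mathbb{K}|_{H,N}=(H,N,I\cap(H\times N))$. A context is clarified if no two distinct objects have the same intent and no two distinct attributes have the same extent. Arrow relations in a context $(G,M,I)$: $g\swarrow m$ iff $(g,m)\notin I$ and every $h\in G$ with $g'\subsetneq h'$ satisfies $(h,m)\in I$; $g\nearrow m$ iff $(g,m)\notin I$ and every $n\in M$ with $m'\subsetneq n'$ satisfies $(g,n)\in I$. -}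

module Defs where

open import Data.Nat using (ℕ; zero; suc)
open import Data.Fin using (Fin; zero; suc)
open import Data.Bool using (Bool; true; false; T; _∧_; if_then_else_)
open import Data.Unit using (tt)
open import Data.Empty using (⊥; ⊥-elim)
open import Data.Product using (Σ; _×_; _,_; proj₁; proj₂)
open import Relation.Nullary using (¬_)
open import Relation.Binary.PropositionalEquality using (_≡_; refl)

record Context : Set where
  field
    nG : ℕ
    nM : ℕ
    I  : Fin nG → Fin nM → Bool

Sub : ℕ → Set
Sub n = Fin n → Bool

_∈_ : ∀ {n} → Fin n → Sub n → Set
x ∈ A = T (A x)

_⊆_ : ∀ {n} → Sub n → Sub n → Set
A ⊆ B = ∀ x → x ∈ A → x ∈ B

_≐_ : ∀ {n} → Sub n → Sub n → Set
A ≐ B = ∀ x → A x ≡ B x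

full : ∀ {n} → Sub n
full _ = true

singleton : ∀ {n} → Fin n → Sub n
singleton zero    zero    = true
singleton zero    (suc _) = false
singleton (suc _) zero    = false
singleton (suc i) (suc j) = singleton i j

_⊊_ : ∀ {n} → (Fin n → Set) → (Fin n → Set) → Set
P ⊊ Q = (∀ x → P x → Q x) × ¬ (∀ x → Q x → P x)

allF : ∀ {n} → (Fin n → Bool) → Bool
allF {zero}  f = true
allF {suc n} f = f zero ∧ allF (λ i → f (suc i))

allF-sound : ∀ {n} (f : Fin n → Bool) → T (allF f) → ∀ i → T (f i)
allF-sound {suc n} f p zero with f zero
... | true = tt
... | false = ⊥-elim p
allF-sound {suc n} f p (suc i) with f zero
... | true = allF-sound (λ j → f (suc j)) p i
... | false = ⊥-elim p

allF-complete : ∀ {n} (f : Fin n → Bool) → (∀ i → T (f i)) → T (allF f)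
allF-complete {zero}  f h = tt
allF-complete {suc n} f h with f zero | h zero
... | true | _ = allF-complete (λ j → f (suc j)) (λ j → h (suc j))
... | false | ()

impl : Bool → Bool → Bool
impl a b = if a then b else true

impl-sound : ∀ a b → T (impl a b) → T a → T b
impl-sound true b p _ = p

impl-complete : ∀ a b → (T a → T b) → T (impl a b)
impl-complete true  b h = h tt
impl-complete false b h = tt

iff→≡ : ∀ a b → (T a → T b) → (T b → T a) → a ≡ b
iff→≡ true  true  _ _ = refl
iff→≡ true  false f _ = ⊥-elim (f tt)
iff→≡ false true  _ g = ⊥-elim (g tt)
iff→≡ false false _ _ = refl

module FCA (K : Context) where
  open Context K

  _′ᴳ : Sub nG → Sub nM
  (A ′ᴳ) m = allF (λ g → impl (A g) (I g m))

  _′ᴹ : Sub nM → Sub nG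
  (B ′ᴹ) g = allF (λ m → impl (B m) (I g m))

  obj′ : Fin nG → Sub nM
  obj′ g = singleton g ′ᴳ

  att′ : Fin nM → Sub nG
  att′ m = singleton m ′ᴹ

  ′ᴳ-sound : ∀ A m → m ∈ (A ′ᴳ) → ∀ g → g ∈ A → T (I g m)
  ′ᴳ-sound A m p g = impl-sound (A g) (I g m) (allF-sound _ p g)

  ′ᴳ-complete : ∀ A m → (∀ g → g ∈ A → T (I g m)) → m ∈ (A ′ᴳ)
  ′ᴳ-complete A m h = allF-complete _ (λ g → impl-complete (A g) (I g m) (h g))

  ′ᴹ-sound : ∀ B g → g ∈ (B ′ᴹ) → ∀ m → m ∈ B → T (I g m)
  ′ᴹ-sound B g p m = impl-sound (B m) (I g m) (allF-sound _ p m)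

  ′ᴹ-complete : ∀ B g → (∀ m → m ∈ B → T (I g m)) → g ∈ (B ′ᴹ)
  ′ᴹ-complete B g h = allF-complete _ (λ m → impl-complete (B m) (I g m) (h m))

  triple-G : ∀ A → (((A ′ᴳ) ′ᴹ) ′ᴳ) ≐ (A ′ᴳ)
  triple-G A m = iff→≡ _ _
    (λ p → ′ᴳ-complete A m (λ g g∈A → ′ᴳ-sound _ m p g
       (′ᴹ-complete (A ′ᴳ) g (λ m′ q → ′ᴳ-sound A m′ q g g∈A))))
    (λ p → ′ᴳ-complete _ m (λ g q → ′ᴹ-sound (A ′ᴳ) g q m p))

  triple-M : ∀ B → (((B ′ᴹ) ′ᴳ) ′ᴹ) ≐ (B ′ᴹ)
  triple-M B g = iff→≡ _ _
    (λ p → ′ᴹ-complete B g (λ m m∈B → ′ᴹ-sound _ g p m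
       (′ᴳ-complete (B ′ᴹ) m (λ g′ q → ′ᴹ-sound B g′ q m m∈B))))
    (λ p → ′ᴹ-complete _ g (λ m q → ′ᴳ-sound (B ′ᴹ) m q g p))

  record Concept : Set where
    field
      extent : Sub nG
      intent : Sub nM
      ext′   : (extent ′ᴳ) ≐ intent
      int′   : (intent ′ᴹ) ≐ extent
  open Concept public

  _≤_ : Concept → Concept → Set
  c ≤ d = extent c ⊆ extent d

  _<_ : Concept → Concept → Set
  c < d = c ≤ d × ¬ (d ≤ c)

  _≈_ : Concept → Concept → Set
  c ≈ d = extent c ≐ extent d

  γ : Fin nG → Concept
  γ g = record { extent = obj′ g ′ᴹ ; intent = obj′ g
               ; ext′ = triple-G (singleton g) ; int′ = λ _ → refl }

  μ : Fin nM → Concept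
  μ m = record { extent = att′ m ; intent = att′ m ′ᴳ
               ; ext′ = λ _ → refl ; int′ = triple-M (singleton m) }

  ↓_ : Concept → Concept → Set
  (↓ c) x = x ≤ c

  ↑_ : Concept → Concept → Set
  (↑ c) x = c ≤ x

  LowerNb : (Concept → Set) → Concept → Concept → Set
  LowerNb P c d = P d × d < c × (∀ e → P e → d < e → e < c → ⊥)

  UpperNb : (Concept → Set) → Concept → Concept → Set
  UpperNb P c d = P d × c < d × (∀ e → P e → c < e → e < d → ⊥)

  SupIrr : (Concept → Set) → Concept → Set
  SupIrr P c = P c × Σ Concept (λ d → LowerNb P c d × (∀ d′ → LowerNb P c d′ → d′ ≈ d))

  InfIrr : (Concept → Set) → Concept → Set
  InfIrr P c = P c × Σ Concept (λ d → UpperNb P c d × (∀ d′ → UpperNb P c d′ → d′ ≈ d))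

  -- arrow relations in the subcontext K|_{H,N} = (H, N, I ∩ (H × N)),
  -- for g ∈ H, n ∈ N.  Derivations in the subcontext:
  --   h′ = { x ∈ N | (h,x) ∈ I },   n′ = { y ∈ H | (y,n) ∈ I }.
  subInt : Sub nM → Fin nG → Fin nM → Set
  subInt N h x = x ∈ N × T (I h x)

  subExt : Sub nG → Fin nM → Fin nG → Set
  subExt H n y = y ∈ H × T (I y n)

  DownArrow : Sub nG → Sub nM → Fin nG → Fin nM → Set
  DownArrow H N g n =
    g ∈ H × n ∈ N × ¬ T (I g n) ×
    (∀ h → h ∈ H → subInt N g ⊊ subInt N h → T (I h n))

  UpArrow : Sub nG → Sub nM → Fin nG → Fin nM → Set
  UpArrow H N g n =
    g ∈ H × n ∈ N × ¬ T (I g n) ×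
    (∀ n₂ → n₂ ∈ N → subExt H n ⊊ subExt H n₂ → T (I g n₂))

{-# OPTIONS --safe #-}
-- In a finite concept lattice every e < c lies below a lower cover of c (the meet of c with μk,
-- for an attribute k ∉ intent c whose extent within extent c is maximal), so c is
-- supremum-irreducible iff it has a greatest strict lower bound; as γg ≤ μm, restricting to (μm]
-- changes nothing. γg has such a bound iff some n ∉ g′ lies in h′ for every h with g′ ⊊ h′,
-- i.e. g ↙ n, and the bound is then γg ∧ μn. Replacing n by an attribute missing g whose extent
-- within m′ is maximal keeps g ↙ n and adds g ↗ n. Part (2) is part (1) for the transposed
-- context, which reverses the concept order and exchanges ↙ and ↗.
module Submission where

open import Defs
open import Data.Fin using (Fin)
open import Data.Bool using (T; _∨_)
open import Data.Bool.Properties using (T-∨)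
open import Data.Empty using (⊥; ⊥-elim)
open import Data.Fin.Properties using (¬∀⟶∃¬; all?)
open import Data.List using ([]; _∷_; allFin)
open import Data.List.Relation.Unary.All using (All; []; _∷_; lookup)
open import Data.List.Membership.Propositional.Properties using (∈-allFin)
open import Data.Product using (Σ; ∃; _×_; _,_; proj₁; proj₂; map₂)
open import Data.Sum using (_⊎_; inj₁; inj₂)
open import Data.Unit using (tt)
open import Function.Bundles using (_⇔_; Equivalence; mk⇔)
open import Function.Properties.Equivalence using () renaming (trans to ⇔-trans)
open import Relation.Binary using (Rel; Reflexive; Transitive; Decidable)
open import Relation.Binary.PropositionalEquality using (_≡_; refl; sym; subst)
open import Relation.Nullary using (¬_; Dec; yes; no; ¬?; _×-dec_; _→-dec_; decidable-stable)
open import Relation.Nullary.Decidable using (T?)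
open import Relation.Unary using (Pred)

open Equivalence using (to; from)

module _ {n ℓ q} {_⊑_ : Rel (Fin n) ℓ} (⊑-refl : Reflexive _⊑_) (⊑-trans : Transitive _⊑_)
         (_⊑?_ : Decidable _⊑_) {Q : Pred (Fin n) q} (Q? : ∀ k → Dec (Q k)) where

  private
    climb : ∀ js k → Q k → Σ (Fin n) λ k′ → Q k′ × k ⊑ k′ × All (λ j → Q j → k′ ⊑ j → j ⊑ k′) js
    climb []       k Qk = k , Qk , ⊑-refl , []
    climb (j ∷ js) k Qk with Q? j ×-dec (k ⊑? j)
    ... | yes (Qj , k⊑j) with climb js j Qj
    ...   | k′ , Qk′ , j⊑k′ , max = k′ , Qk′ , ⊑-trans k⊑j j⊑k′ , (λ _ _ → j⊑k′) ∷ max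
    climb (j ∷ js) k Qk | no ¬[Qj×k⊑j] with climb js k Qk
    ...   | k′ , Qk′ , k⊑k′ , max =
      k′ , Qk′ , k⊑k′ , (λ Qj k′⊑j → ⊥-elim (¬[Qj×k⊑j] (Qj , ⊑-trans k⊑k′ k′⊑j))) ∷ max

  maximal-above : ∀ k → Q k → Σ (Fin n) λ k′ → Q k′ × k ⊑ k′ × (∀ j → Q j → k′ ⊑ j → j ⊑ k′)
  maximal-above k Qk with climb (allFin n) k Qk
  ... | k′ , Qk′ , k⊑k′ , max = k′ , Qk′ , k⊑k′ , λ j → lookup max (∈-allFin j)

≐⇒⊆ : ∀ {n} {A B : Sub n} → A ≐ B → A ⊆ B
≐⇒⊆ A≐B x = subst T (A≐B x)

≐⇒⊇ : ∀ {n} {A B : Sub n} → A ≐ B → B ⊆ A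
≐⇒⊇ A≐B x = subst T (sym (A≐B x))

⊈⇒∃ : ∀ {n} {A B : Sub n} → ¬ (A ⊆ B) → ∃ λ x → x ∈ A × ¬ x ∈ B
⊈⇒∃ {n} {A} {B} A⊈B with ¬∀⟶∃¬ n (λ x → x ∈ A → x ∈ B) (λ x → T? (A x) →-dec T? (B x)) A⊈B
... | x , x∉A⇒B = x , decidable-stable (T? (A x)) (λ x∉A → x∉A⇒B (λ x∈A → ⊥-elim (x∉A x∈A)))
                    , λ x∈B → x∉A⇒B (λ _ → x∈B)

singleton-refl : ∀ {n} (k : Fin n) → k ∈ singleton k
singleton-refl Fin.zero    = tt
singleton-refl (Fin.suc k) = singleton-refl k

singleton-≡ : ∀ {n} {k x : Fin n} → x ∈ singleton k → k ≡ x
singleton-≡ {k = Fin.zero}  {Fin.zero}  _ = refl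
singleton-≡ {k = Fin.suc k} {Fin.suc x} p with singleton-≡ {k = k} {x} p
... | refl = refl

module ConceptLattice (K : Context) where
  open Context K public
  open FCA K public

  module _ (c : Concept) where

    extent-sound : ∀ {x y} → x ∈ extent c → y ∈ intent c → T (I x y)
    extent-sound {x} {y} x∈c = ′ᴹ-sound (intent c) x (≐⇒⊇ (int′ c) x x∈c) y

    extent-complete : ∀ {x} → (∀ y → y ∈ intent c → T (I x y)) → x ∈ extent c
    extent-complete {x} h = ≐⇒⊆ (int′ c) x (′ᴹ-complete (intent c) x h)

    intent-complete : ∀ {y} → (∀ x → x ∈ extent c → T (I x y)) → y ∈ intent c
    intent-complete {y} h = ≐⇒⊆ (ext′ c) y (′ᴳ-complete (extent c) y h)

  ∈-obj′ : ∀ {g y} → y ∈ obj′ g ⇔ T (I g y)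
  ∈-obj′ {g} {y} = mk⇔ (λ p → ′ᴳ-sound (singleton g) y p g (singleton-refl g))
    (λ gIy → ′ᴳ-complete (singleton g) y λ x x∈g → subst (λ z → T (I z y)) (singleton-≡ x∈g) gIy)

  ∈-att′ : ∀ {m x} → x ∈ att′ m ⇔ T (I x m)
  ∈-att′ {m} {x} = mk⇔ (λ p → ′ᴹ-sound (singleton m) x p m (singleton-refl m))
    (λ xIm → ′ᴹ-complete (singleton m) x λ y y∈m → subst (λ z → T (I x z)) (singleton-≡ y∈m) xIm)

  ∈-γ : ∀ {g x} → x ∈ extent (γ g) ⇔ (∀ y → T (I g y) → T (I x y))
  ∈-γ {g} {x} = mk⇔ (λ p y gIy → ′ᴹ-sound (obj′ g) x p y (from ∈-obj′ gIy))
                    (λ h → ′ᴹ-complete (obj′ g) x λ y y∈g′ → h y (to ∈-obj′ y∈g′))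

  γ-self : ∀ g → g ∈ extent (γ g)
  γ-self g = from ∈-γ λ _ gIy → gIy

  γ≤⇔∈ : ∀ {g c} → γ g ≤ c ⇔ g ∈ extent c
  γ≤⇔∈ {g} {c} = mk⇔ (λ γg≤c → γg≤c g (γ-self g))
    (λ g∈c x x∈γg → extent-complete c λ y y∈c → to ∈-γ x∈γg y (extent-sound c g∈c y∈c))

  ≤-trans : ∀ {a b c} → a ≤ b → b ≤ c → a ≤ c
  ≤-trans a≤b b≤c x x∈a = b≤c x (a≤b x x∈a)

  ≤-<-trans : ∀ {a b c} → a ≤ b → b < c → a < c
  ≤-<-trans {a} {b} {c} a≤b (b≤c , c≰b) =
    ≤-trans {a} {b} {c} a≤b b≤c , λ c≤a → c≰b (≤-trans {c} {a} {b} c≤a a≤b)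

  _≤?_ : ∀ c d → Dec (c ≤ d)
  c ≤? d = all? λ x → T? (extent c x) →-dec T? (extent d x)

  ≤-stable : ∀ {c d} → ¬ ¬ c ≤ d → c ≤ d
  ≤-stable {c} {d} = decidable-stable (c ≤? d)

  ≤-antisym : ∀ {c d} → c ≤ d → d ≤ c → c ≈ d
  ≤-antisym c≤d d≤c x = iff→≡ _ _ (c≤d x) (d≤c x)

  ≈⇒≤ : ∀ {c d} → c ≈ d → c ≤ d
  ≈⇒≤ = ≐⇒⊆

  ≈⇒≥ : ∀ {c d} → c ≈ d → d ≤ c
  ≈⇒≥ = ≐⇒⊇

  ≤⇔intent-⊇ : ∀ {c d} → c ≤ d ⇔ intent d ⊆ intent c
  ≤⇔intent-⊇ {c} {d} = mk⇔
    (λ c≤d y y∈d → intent-complete c λ x x∈c → extent-sound d (c≤d x x∈c) y∈d)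
    (λ d⊆c x x∈c → extent-complete d λ y y∈d → extent-sound c x∈c (d⊆c y y∈d))

  <⇒∃-intent : ∀ {c d} → d < c → ∃ λ y → y ∈ intent d × ¬ y ∈ intent c
  <⇒∃-intent {c} {d} (_ , c≰d) = ⊈⇒∃ (λ d⊆c → c≰d (from (≤⇔intent-⊇ {c} {d}) d⊆c))

  fromIntent : Sub nM → Concept
  fromIntent B = record
    { extent = B ′ᴹ ; intent = (B ′ᴹ) ′ᴳ ; ext′ = λ _ → refl ; int′ = triple-M B }

  infixl 30 _⊓_
  _⊓_ : Concept → Concept → Concept
  c ⊓ d = fromIntent λ y → intent c y ∨ intent d y

  ∈-⊓ : ∀ {c d x} → x ∈ extent (c ⊓ d) ⇔ (x ∈ extent c × x ∈ extent d)
  ∈-⊓ {c} {d} {x} = mk⇔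
    (λ p → extent-complete c (λ y y∈c → ′ᴹ-sound _ x p y (from T-∨ (inj₁ y∈c)))
         , extent-complete d (λ y y∈d → ′ᴹ-sound _ x p y (from T-∨ (inj₂ y∈d))))
    (λ (x∈c , x∈d) → ′ᴹ-complete _ x λ y y∈c∨d → case-∨ x∈c x∈d (to T-∨ y∈c∨d))
    where
    case-∨ : ∀ {y} → x ∈ extent c → x ∈ extent d → T (intent c y) ⊎ T (intent d y) → T (I x y)
    case-∨ x∈c _ (inj₁ y∈c) = extent-sound c x∈c y∈c
    case-∨ _ x∈d (inj₂ y∈d) = extent-sound d x∈d y∈d

  ⊓-≤ˡ : ∀ {c d} → c ⊓ d ≤ c
  ⊓-≤ˡ {c} {d} x x∈c⊓d = proj₁ (to (∈-⊓ {c} {d}) x∈c⊓d)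

  _⊑⟨_⟩_ : Fin nM → Sub nG → Fin nM → Set
  k ⊑⟨ S ⟩ j = ∀ x → x ∈ S → T (I x k) → T (I x j)

  maximal-extent-in : ∀ S {q} {Q : Pred (Fin nM) q} → (∀ k → Dec (Q k)) → ∀ k → Q k →
                      ∃ λ k′ → Q k′ × k ⊑⟨ S ⟩ k′ × (∀ j → Q j → k′ ⊑⟨ S ⟩ j → j ⊑⟨ S ⟩ k′)
  maximal-extent-in S = maximal-above {_⊑_ = _⊑⟨ S ⟩_} (λ _ _ xIk → xIk)
    (λ k⊑j j⊑l x x∈S xIk → j⊑l x x∈S (k⊑j x x∈S xIk))
    (λ k j → all? λ x → T? (S x) →-dec T? (I x k) →-dec T? (I x j))

  _⋖_ : Concept → Concept → Set
  d ⋖ c = d < c × (∀ e → d < e → e < c → ⊥)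

  lower-cover-above : ∀ {e c} → e < c → ∃ λ d → d ⋖ c × e ≤ d
  lower-cover-above {e} {c} e<c@(e≤c , _) with <⇒∃-intent {c} {e} e<c
  ... | k₀ , k₀∈e , k₀∉c with maximal-extent-in (extent c) (λ k → ¬? (T? (intent c k))) k₀ k₀∉c
  ...   | k , k∉c , k₀⊑k , k-max = c ⊓ μ k , (d<c , nothing-between) , e≤d
    where
    d<c : c ⊓ μ k < c
    d<c = ⊓-≤ˡ {c} {μ k} , λ c≤d → k∉c (intent-complete c λ x x∈c →
            to ∈-att′ (proj₂ (to (∈-⊓ {c} {μ k}) (c≤d x x∈c))))
    e≤d : e ≤ c ⊓ μ k
    e≤d x x∈e = from (∈-⊓ {c} {μ k})
      (e≤c x x∈e , from ∈-att′ (k₀⊑k x (e≤c x x∈e) (extent-sound e x∈e k₀∈e)))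
    nothing-between : ∀ f → c ⊓ μ k < f → f < c → ⊥
    nothing-between f (d≤f , f≰d) f<c@(f≤c , _) with <⇒∃-intent {c} {f} f<c
    ... | j , j∈f , j∉c = f≰d f≤d
      where
      k⊑j : k ⊑⟨ extent c ⟩ j
      k⊑j x x∈c xIk = extent-sound f (d≤f x (from (∈-⊓ {c} {μ k}) (x∈c , from ∈-att′ xIk))) j∈f
      f≤d : f ≤ c ⊓ μ k
      f≤d x x∈f = from (∈-⊓ {c} {μ k})
        (f≤c x x∈f , from ∈-att′ (k-max j j∉c k⊑j x (f≤c x x∈f) (extent-sound f x∈f j∈f)))

  GreatestBelow : Concept → Concept → Set
  GreatestBelow c d = d < c × (∀ e → e < c → e ≤ d)

  SupIrr⇔GreatestBelow : ∀ {P c} → P c → (∀ e → e ≤ c → P e) → SupIrr P c ⇔ ∃ (GreatestBelow c)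
  SupIrr⇔GreatestBelow {P} {c} Pc P-below = mk⇔ greatest irreducible
    where
    greatest : SupIrr P c → ∃ (GreatestBelow c)
    greatest (_ , d , (_ , d<c , _) , unique) = d , d<c , below-d
      where
      below-d : ∀ e → e < c → e ≤ d
      below-d e e<c with lower-cover-above {e} {c} e<c
      ... | d′ , (d′<c , d′⋖c) , e≤d′ = ≤-trans {e} {d′} {d} e≤d′
        (≈⇒≤ {d′} {d} (unique d′ (P-below d′ (proj₁ d′<c) , d′<c , λ f _ → d′⋖c f)))
    irreducible : ∃ (GreatestBelow c) → SupIrr P c
    irreducible (d , d<c , below-d) =
      Pc , d , (Pd , d<c , λ e _ d<e e<c → proj₂ d<e (below-d e e<c)) , unique
      where
      Pd : P d
      Pd = P-below d (proj₁ d<c)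
      unique : ∀ d′ → LowerNb P c d′ → d′ ≈ d
      unique d′ (_ , d′<c , nothing-between) = ≤-antisym {d′} {d} (below-d d′ d′<c)
        (≤-stable {d} {d′} λ d≰d′ → nothing-between d Pd (below-d d′ d′<c , d≰d′) d<c)

  DoubleArrow : Sub nG → Sub nM → Fin nG → Fin nM → Set
  DoubleArrow H N g n = DownArrow H N g n × UpArrow H N g n

  DownArrow⇒DoubleArrow : ∀ {H N g n} → DownArrow H N g n → ∃ (DoubleArrow H N g)
  DownArrow⇒DoubleArrow {H} {N} {g} {n} (g∈H , n∈N , ¬gIn , g↙n)
    with maximal-extent-in H (λ k → T? (N k) ×-dec ¬? (T? (I g k))) n (n∈N , ¬gIn)
  ... | n₂ , (n₂∈N , ¬gIn₂) , n⊑n₂ , n₂-max =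
    n₂ , (g∈H , n₂∈N , ¬gIn₂ , λ h h∈H g′⊊h′ → n⊑n₂ h h∈H (g↙n h h∈H g′⊊h′))
       , (g∈H , n₂∈N , ¬gIn₂ , g↗n₂)
    where
    g↗n₂ : ∀ n₃ → n₃ ∈ N → subExt H n₂ ⊊ subExt H n₃ → T (I g n₃)
    g↗n₂ n₃ n₃∈N (n₂′⊆n₃′ , n₃′⊈n₂′) = decidable-stable (T? (I g n₃)) λ ¬gIn₃ →
      n₃′⊈n₂′ λ x (x∈H , xIn₃) → x∈H , n₂-max n₃ (n₃∈N , ¬gIn₃)
        (λ y y∈H yIn₂ → proj₂ (n₂′⊆n₃′ y (y∈H , yIn₂))) x x∈H xIn₃

  γ≤γ⇔intent-⊇ : ∀ {g h} → γ h ≤ γ g ⇔ (∀ y → T (I g y) → T (I h y))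
  γ≤γ⇔intent-⊇ {g} {h} = ⇔-trans (γ≤⇔∈ {h} {γ g}) ∈-γ

  γ<γ⇔⊊ : ∀ {g h} → γ h < γ g ⇔ subInt full g ⊊ subInt full h
  γ<γ⇔⊊ {g} {h} = mk⇔
    (λ (h≤g , g≰h) → (λ y (_ , gIy) → tt , to γ≤γ⇔intent-⊇ h≤g y gIy)
                   , λ h′⊆g′ → g≰h (from γ≤γ⇔intent-⊇ λ y hIy → proj₂ (h′⊆g′ y (tt , hIy))))
    (λ (g′⊆h′ , h′⊈g′) → from γ≤γ⇔intent-⊇ (λ y gIy → proj₂ (g′⊆h′ y (tt , gIy)))
                       , λ g≤h → h′⊈g′ λ y (_ , hIy) → tt , to γ≤γ⇔intent-⊇ g≤h y hIy)

  GreatestBelow⇒DownArrow : ∀ {H g d} → g ∈ H → GreatestBelow (γ g) d → ∃ (DownArrow H full g)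
  GreatestBelow⇒DownArrow {H} {g} {d} g∈H (d<γg , below-d) with <⇒∃-intent {γ g} {d} d<γg
  ... | n , n∈d , n∉g′ = n , g∈H , tt , (λ gIn → n∉g′ (from ∈-obj′ gIn))
    , λ h _ g′⊊h′ → extent-sound d (to (γ≤⇔∈ {h} {d}) (below-d (γ h) (from γ<γ⇔⊊ g′⊊h′))) n∈d

  DownArrow⇒GreatestBelow : ∀ {H g n} → extent (γ g) ⊆ H → DownArrow H full g n →
                            GreatestBelow (γ g) (γ g ⊓ μ n)
  DownArrow⇒GreatestBelow {H} {g} {n} γg⊆H (_ , _ , ¬gIn , g↙n) =
    (⊓-≤ˡ {γ g} {μ n} , λ γg≤⊓ →
       ¬gIn (to ∈-att′ (proj₂ (to (∈-⊓ {γ g} {μ n}) (γg≤⊓ g (γ-self g))))))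
      , below
    where
    below : ∀ e → e < γ g → e ≤ γ g ⊓ μ n
    below e e<γg x x∈e = from (∈-⊓ {γ g} {μ n}) (x∈γg , from ∈-att′ (g↙n x (γg⊆H x x∈γg)
      (to γ<γ⇔⊊ (≤-<-trans {γ x} {e} {γ g} (from (γ≤⇔∈ {x} {e}) x∈e) e<γg))))
      where
      x∈γg : x ∈ extent (γ g)
      x∈γg = proj₁ e<γg x x∈e

  SupIrr-γ⇔DoubleArrow : ∀ {g m} → T (I g m) →
                         SupIrr (↓ μ m) (γ g) ⇔ ∃ (DoubleArrow (att′ m) full g)
  SupIrr-γ⇔DoubleArrow {g} {m} gIm =
    ⇔-trans (SupIrr⇔GreatestBelow {↓ μ m} {γ g} γg≤μm λ e e≤γg → ≤-trans {e} {γ g} {μ m} e≤γg γg≤μm)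
            (mk⇔ arrows greatest)
    where
    γg≤μm : γ g ≤ μ m
    γg≤μm = from (γ≤⇔∈ {g} {μ m}) (from ∈-att′ gIm)
    arrows : ∃ (GreatestBelow (γ g)) → ∃ (DoubleArrow (att′ m) full g)
    arrows (d , greatest) =
      DownArrow⇒DoubleArrow
        (proj₂ (GreatestBelow⇒DownArrow {att′ m} {g} {d} (γg≤μm g (γ-self g)) greatest))
    greatest : ∃ (DoubleArrow (att′ m) full g) → ∃ (GreatestBelow (γ g))
    greatest (n , g↙n , _) = γ g ⊓ μ n , DownArrow⇒GreatestBelow γg≤μm g↙n

dual : Context → Context
dual K = record { nG = Context.nM K ; nM = Context.nG K ; I = λ m g → Context.I K g m }

module _ {K : Context} where
  open FCA K

  dualᶜ : Concept → FCA.Concept (dual K)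
  dualᶜ c = record { extent = intent c ; intent = extent c ; ext′ = int′ c ; int′ = ext′ c }

module Duality (K : Context) where
  open ConceptLattice K
  module D = ConceptLattice (dual K)

  ≤⇔dual-≥ : ∀ {c d} → c ≤ d ⇔ dualᶜ d D.≤ dualᶜ c
  ≤⇔dual-≥ {c} {d} = ≤⇔intent-⊇ {c} {d}

  <⇔dual-> : ∀ {c d} → c < d ⇔ dualᶜ d D.< dualᶜ c
  <⇔dual-> {c} {d} = mk⇔
    (λ (c≤d , d≰c) → to (≤⇔dual-≥ {c} {d}) c≤d , λ c≤d′ → d≰c (from (≤⇔dual-≥ {d} {c}) c≤d′))
    (λ (d≤c′ , c≰d′) → from (≤⇔dual-≥ {c} {d}) d≤c′ , λ d≤c → c≰d′ (to (≤⇔dual-≥ {d} {c}) d≤c))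

  ≈⇔dual-≈ : ∀ {c d} → c ≈ d ⇔ dualᶜ c D.≈ dualᶜ d
  ≈⇔dual-≈ {c} {d} = mk⇔
    (λ c≈d → D.≤-antisym {dualᶜ c} {dualᶜ d} (to (≤⇔dual-≥ {d} {c}) (≈⇒≥ {c} {d} c≈d))
                                             (to (≤⇔dual-≥ {c} {d}) (≈⇒≤ {c} {d} c≈d)))
    (λ c≈d′ → ≤-antisym {c} {d} (from (≤⇔dual-≥ {c} {d}) (D.≈⇒≥ {dualᶜ c} {dualᶜ d} c≈d′))
                                (from (≤⇔dual-≥ {d} {c}) (D.≈⇒≤ {dualᶜ c} {dualᶜ d} c≈d′)))

  module _ {Q : Concept → Set} {P : D.Concept → Set} (Q⇔P : ∀ {x} → Q x ⇔ P (dualᶜ x)) where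

    UpperNb⇔dual-LowerNb : ∀ {c d} → UpperNb Q c d ⇔ D.LowerNb P (dualᶜ c) (dualᶜ d)
    UpperNb⇔dual-LowerNb {c} {d} = mk⇔
      (λ (Qd , c<d , nothing-between) → to Q⇔P Qd , to (<⇔dual-> {c} {d}) c<d ,
         λ e Pe d<e e<c → nothing-between (dualᶜ e) (from Q⇔P Pe)
           (from (<⇔dual-> {c} {dualᶜ e}) e<c) (from (<⇔dual-> {dualᶜ e} {d}) d<e))
      (λ (Pd , d<c , nothing-between) → from Q⇔P Pd , from (<⇔dual-> {c} {d}) d<c ,
         λ e Qe c<e e<d → nothing-between (dualᶜ e) (to Q⇔P Qe)
           (to (<⇔dual-> {e} {d}) e<d) (to (<⇔dual-> {c} {e}) c<e))

    InfIrr⇔dual-SupIrr : ∀ {c} → InfIrr Q c ⇔ D.SupIrr P (dualᶜ c)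
    InfIrr⇔dual-SupIrr {c} = mk⇔
      (λ (Qc , d , d-cover , unique) →
         to Q⇔P Qc , dualᶜ d , to (UpperNb⇔dual-LowerNb {c} {d}) d-cover ,
         λ d′ d′-cover → to (≈⇔dual-≈ {dualᶜ d′} {d})
           (unique (dualᶜ d′) (from (UpperNb⇔dual-LowerNb {c} {dualᶜ d′}) d′-cover)))
      (λ (Pc , d , d-cover , unique) →
         from Q⇔P Pc , dualᶜ d , from (UpperNb⇔dual-LowerNb {c} {dualᶜ d}) d-cover ,
         λ d′ d′-cover → from (≈⇔dual-≈ {d′} {dualᶜ d})
           (unique (dualᶜ d′) (to (UpperNb⇔dual-LowerNb {c} {d′}) d′-cover)))

  DoubleArrowᵈ⇔DoubleArrow : ∀ {B A m g} → D.DoubleArrow B A m g ⇔ DoubleArrow A B g m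
  DoubleArrowᵈ⇔DoubleArrow = mk⇔ (λ (m↙g , m↗g) → swap m↗g , swap m↙g)
                                 (λ (g↙m , g↗m) → swap g↗m , swap g↙m)
    where
    swap : ∀ {X Y Z : Set} → X × Y × Z → Y × X × Z
    swap (x , y , z) = y , x , z

  InfIrr-μ⇔DoubleArrow : ∀ {g m} → T (I g m) →
                         InfIrr (↑ γ g) (μ m) ⇔ ∃ λ h → DoubleArrow full (obj′ g) h m
  InfIrr-μ⇔DoubleArrow {g} {m} gIm =
    ⇔-trans (InfIrr⇔dual-SupIrr (λ {x} → ≤⇔dual-≥ {γ g} {x}) {μ m})
      (⇔-trans (D.SupIrr-γ⇔DoubleArrow gIm)
               (mk⇔ (map₂ (to DoubleArrowᵈ⇔DoubleArrow)) (map₂ (from DoubleArrowᵈ⇔DoubleArrow))))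

lemma6 : (K : Context) (g : Fin (Context.nG K)) (m : Fin (Context.nM K)) →
    T (Context.I K g m) →
    let open FCA K in
    (SupIrr (↓ μ m) (γ g) ⇔
       Σ (Fin (Context.nM K)) (λ n → DownArrow (att′ m) full g n × UpArrow (att′ m) full g n))
    ×
    (InfIrr (↑ γ g) (μ m) ⇔
       Σ (Fin (Context.nG K)) (λ h → DownArrow full (obj′ g) h m × UpArrow full (obj′ g) h m))
lemma6 K g m gIm = SupIrr-γ⇔DoubleArrow gIm , InfIrr-μ⇔DoubleArrow gIm
  where
  open ConceptLattice K
  open Duality K
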